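{- Let $(x_n)$ be defined by $x_n=2x_{n-1}+2x_{n-2}+x_{n-3}$ with $x_0=0$, $x_1=1$, $x_2=2$. For $n\ge1$, $$\nu_2(x_n)=\begin{cases}0,& n\equiv 1,4\pmod 6,\\ 1,& n\equiv 2,3\pmod 6,\\ 2+\nu_2(n),& n\equiv 0\pmod 6,\\ 3+\nu_2(n+1),& n\equiv 5\pmod 6.\end{cases}$$
   Context: $\nu_2(m)$ denotes the exponent of the highest power of $2$ dividing the nonzero integer $m$. -}

module Defs where

open import Data.Nat using (ℕ; zero; suc; _+_; _*_; _^_)
open import Data.Nat.Divisibility using (_∣_)
open import Data.Product using (_×_)
open import Relation.Nullary using (¬_)

x : ℕ → ℕ
x 0 = 0
x 1 = 1
x 2 = 2
x (suc (suc (suc n))) = 2 * x (suc (suc n)) + 2 * x (suc n) + x n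

-- ν₂ m ≡ k : 2^k is the highest power of 2 dividing m (only meaningful for m ≠ 0)
Nu2 : ℕ → ℕ → Set
Nu2 m k = (2 ^ k ∣ m) × ¬ (2 ^ suc k ∣ m)

module Submission where

-- The sequence satisfies the addition formula
--   x (m + n + 3) = x m · x (n + 1) + x (m + 1) · (2 x (n + 1) + x n) + x (m + 2) · x (n + 2),
-- because both sides solve the recurrence in m. Modulo 4 the sequence has period 6 and modulo 32
-- period 24; this settles the residues 1, 2, 3, 4 mod 6 and, for odd m, gives ν₂ (x (6m − 1)) = 4
-- and ν₂ (x (6m)) = 3. Taking m = n = i and m = i + 1, n = i in the addition formula expresses
-- x (2i + 3) and x (2i + 4) through x i, x (i + 1), x (i + 2). At i = 6m − 2, where x i is odd,
-- one product in each formula has valuation exactly one more than before and the remaining square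
-- is divisible by a higher power of 2, so passing from m to 2m raises both valuations by one.
-- Induction on ν₂ m then gives ν₂ (x (6m − 1)) = 4 + ν₂ m and ν₂ (x (6m)) = 3 + ν₂ m.

open import Defs
open import Algebra.Properties.CommutativeSemigroup as CommSemigroupProperties using ()
open import Data.Nat using (ℕ; zero; suc; _+_; _*_; _^_; _%_; _/_; _≤_; _<_; s≤s; NonZero)
open import Data.Nat.Properties
  using (+-comm; +-identityʳ; *-assoc; ^-distribˡ-+-*; m^n≢0; m≤m*n; 0≢1+n;
         +-commutativeSemigroup; *-commutativeSemigroup)
open import Data.Nat.DivMod using (%-distribˡ-+; %-distribˡ-*; m≡m%n+[m/n]*n; [m+kn]%n≡m%n)
open import Data.Nat.Divisibility
  using (_∣_; divides; _∣?_; ∣-refl; ∣-trans; ∣m∣n⇒∣m+n; ∣m+n∣m⇒∣n; n∣m*n; m∣m*n;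
         *-pres-∣; *-monoˡ-∣; *-cancelʳ-∣; m*n∣⇒m∣; n∣m⇒m%n≡0; %-presˡ-∣; ∣n∣m%n⇒∣m; 1∣_)
open import Data.Nat.Induction using (<-rec)
open import Data.Nat.Primality using (euclidsLemma; prime[2])
open import Data.Nat.Tactic.RingSolver using (solve-∀)
open import Data.Product using (_×_; _,_; ∃; proj₁)
open import Data.Sum using (_⊎_; inj₁; inj₂; [_,_])
open import Function using (_∘_)
open import Relation.Nullary using (¬_)
open import Relation.Nullary.Decidable using (Dec; _×-dec_; ¬?; from-yes)
open import Relation.Binary.PropositionalEquality
  using (_≡_; refl; sym; trans; cong; cong₂; subst; subst₂; module ≡-Reasoning)

open CommSemigroupProperties +-commutativeSemigroup using (x∙yz≈y∙xz)
open CommSemigroupProperties *-commutativeSemigroup using (interchange)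

even⊎odd : ∀ n → ∃ λ t → n ≡ t * 2 ⊎ n ≡ 1 + t * 2
even⊎odd zero = 0 , inj₁ refl
even⊎odd (suc n) with even⊎odd n
... | t , inj₁ refl = t , inj₂ refl
... | t , inj₂ refl = suc t , inj₁ refl

m^[n+o]∣⇒m^n∣ : ∀ m n o {d} → m ^ (n + o) ∣ d → m ^ n ∣ d
m^[n+o]∣⇒m^n∣ m n o m^[n+o]∣d =
  m*n∣⇒m∣ (m ^ n) (m ^ o) (subst (_∣ _) (^-distribˡ-+-* m n o) m^[n+o]∣d)

*-pres-^∣ : ∀ m i j {a b} → m ^ i ∣ a → m ^ j ∣ b → m ^ (i + j) ∣ a * b
*-pres-^∣ m i j mⁱ∣a mʲ∣b = subst (_∣ _) (sym (^-distribˡ-+-* m i j)) (*-pres-∣ mⁱ∣a mʲ∣b)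

Nu2? : ∀ m k → Dec (Nu2 m k)
Nu2? m k = 2 ^ k ∣? m ×-dec ¬? (2 ^ suc k ∣? m)

-- Exponents are explicit arguments throughout: Agda cannot recover k from 2 ^ k.
Nu2⇒oddPart : ∀ {a} k → Nu2 a k → ∃ λ p → a ≡ p * 2 ^ k × ¬ 2 ∣ p
Nu2⇒oddPart k (divides p refl , 2ᵏ⁺¹∤a) =
  p , refl , λ 2∣p → 2ᵏ⁺¹∤a (*-monoˡ-∣ {n = p} (2 ^ k) 2∣p)

oddPart⇒Nu2 : ∀ {p} k → ¬ 2 ∣ p → Nu2 (p * 2 ^ k) k
oddPart⇒Nu2 {p} k 2∤p =
  n∣m*n p , λ 2ᵏ⁺¹∣ → 2∤p (*-cancelʳ-∣ (2 ^ k) {{m^n≢0 2 k}} 2ᵏ⁺¹∣)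

Nu2-* : ∀ {a b} i j → Nu2 a i → Nu2 b j → Nu2 (a * b) (i + j)
Nu2-* i j νa νb with Nu2⇒oddPart i νa | Nu2⇒oddPart j νb
... | p , refl , 2∤p | q , refl , 2∤q =
  subst (λ c → Nu2 c (i + j)) regroup (oddPart⇒Nu2 (i + j) ([ 2∤p , 2∤q ] ∘ euclidsLemma p q prime[2]))
  where
  open ≡-Reasoning
  regroup : p * q * 2 ^ (i + j) ≡ p * 2 ^ i * (q * 2 ^ j)
  regroup = begin
    p * q * 2 ^ (i + j)         ≡⟨ cong (p * q *_) (^-distribˡ-+-* 2 i j) ⟩
    p * q * (2 ^ i * 2 ^ j)     ≡⟨ interchange p q (2 ^ i) (2 ^ j) ⟩
    p * 2 ^ i * (q * 2 ^ j)     ∎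

Nu2-*-suc : ∀ {a b} k → Nu2 a k → Nu2 b 1 → Nu2 (a * b) (suc k)
Nu2-*-suc k νa νb = subst (Nu2 _) (+-comm k 1) (Nu2-* k 1 νa νb)

Nu2-+ : ∀ {a b} k → Nu2 a k → 2 ^ suc k ∣ b → Nu2 (a + b) k
Nu2-+ {a} {b} k (2ᵏ∣a , 2ᵏ⁺¹∤a) 2ᵏ⁺¹∣b =
  ∣m∣n⇒∣m+n 2ᵏ∣a (∣-trans (n∣m*n 2) 2ᵏ⁺¹∣b) ,
  λ 2ᵏ⁺¹∣a+b → 2ᵏ⁺¹∤a (∣m+n∣m⇒∣n (subst (2 ^ suc k ∣_) (+-comm a b) 2ᵏ⁺¹∣a+b) 2ᵏ⁺¹∣b)

∣-cong-% : ∀ {d M a b} .{{_ : NonZero M}} → d ∣ M → a % M ≡ b % M → d ∣ a → d ∣ b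
∣-cong-% {d} d∣M a≡b d∣a = ∣n∣m%n⇒∣m d∣M (subst (d ∣_) a≡b (%-presˡ-∣ d∣a d∣M))

Nu2-cong-% : ∀ k {M a b} .{{_ : NonZero M}} → 2 ^ suc k ∣ M → a % M ≡ b % M → Nu2 a k → Nu2 b k
Nu2-cong-% k 2ᵏ⁺¹∣M a≡b (2ᵏ∣a , 2ᵏ⁺¹∤a) =
  ∣-cong-% (∣-trans (n∣m*n 2) 2ᵏ⁺¹∣M) a≡b 2ᵏ∣a ,
  λ 2ᵏ⁺¹∣b → 2ᵏ⁺¹∤a (∣-cong-% 2ᵏ⁺¹∣M (sym a≡b) 2ᵏ⁺¹∣b)

Nu2-odd : ∀ t → Nu2 (1 + t * 2) 0
Nu2-odd t = 1∣ _ , λ 2∣ → 0≢1+n (trans (sym (n∣m⇒m%n≡0 _ 2 2∣)) ([m+kn]%n≡m%n 1 t 2))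

Nu2-2 : Nu2 2 1
Nu2-2 = from-yes (Nu2? 2 1)

Nu2-6 : Nu2 6 1
Nu2-6 = from-yes (Nu2? 6 1)

record IsSolution (f : ℕ → ℕ) : Set where
  constructor isSolution
  field recurrence : ∀ n → f (3 + n) ≡ 2 * f (2 + n) + 2 * f (1 + n) + f n

open IsSolution

IsSolution-*ʳ : ∀ {f} → IsSolution f → ∀ c → IsSolution (λ n → f n * c)
IsSolution-*ʳ {f} f-sol c = isSolution λ n →
  trans (cong (_* c) (recurrence f-sol n)) (distrib (f (2 + n)) (f (1 + n)) (f n) c)
  where
  distrib : ∀ u v w c → (2 * u + 2 * v + w) * c ≡ 2 * (u * c) + 2 * (v * c) + w * c
  distrib = solve-∀

IsSolution-+ : ∀ {f g} → IsSolution f → IsSolution g → IsSolution (λ n → f n + g n)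
IsSolution-+ {f} {g} f-sol g-sol = isSolution λ n →
  trans (cong₂ _+_ (recurrence f-sol n) (recurrence g-sol n))
        (regroup (f (2 + n)) (f (1 + n)) (f n) (g (2 + n)) (g (1 + n)) (g n))
  where
  regroup : ∀ u v w u′ v′ w′ →
            (2 * u + 2 * v + w) + (2 * u′ + 2 * v′ + w′) ≡ 2 * (u + u′) + 2 * (v + v′) + (w + w′)
  regroup = solve-∀

IsSolution-suc : ∀ {f} → IsSolution f → IsSolution (λ n → f (suc n))
IsSolution-suc f-sol = isSolution λ n → recurrence f-sol (suc n)

solutions-related : (R : ℕ → ℕ → Set) →
  (∀ {a b c a′ b′ c′} → R a a′ → R b b′ → R c c′ →
    R (2 * c + 2 * b + a) (2 * c′ + 2 * b′ + a′)) →
  ∀ {f g} → IsSolution f → IsSolution g →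
  R (f 0) (g 0) → R (f 1) (g 1) → R (f 2) (g 2) → ∀ n → R (f n) (g n)
solutions-related R R-step {f} {g} f-sol g-sol r₀ r₁ r₂ n = proj₁ (windows n)
  where
  windows : ∀ n → R (f n) (g n) × R (f (1 + n)) (g (1 + n)) × R (f (2 + n)) (g (2 + n))
  windows zero    = r₀ , r₁ , r₂
  windows (suc n) = let r , r′ , r″ = windows n in
    r′ , r″ , subst₂ R (sym (recurrence f-sol n)) (sym (recurrence g-sol n)) (R-step r r′ r″)

solutions-equal : ∀ {f g} → IsSolution f → IsSolution g →
                  f 0 ≡ g 0 → f 1 ≡ g 1 → f 2 ≡ g 2 → ∀ n → f n ≡ g n
solutions-equal = solutions-related _≡_ λ { refl refl refl → refl }

x-isSolution : IsSolution x
x-isSolution = isSolution λ _ → refl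

x-shift-isSolution : ∀ s → IsSolution (λ n → x (n + s))
x-shift-isSolution s = isSolution λ _ → refl

x-+ : ∀ m n →
      x (m + (3 + n)) ≡ x m * x (1 + n) + x (1 + m) * (2 * x (1 + n) + x n) + x (2 + m) * x (2 + n)
x-+ m n = solutions-equal (x-shift-isSolution (3 + n)) combination
                          (initial₀ a b c) (initial₁ a b c) (initial₂ a b c) m
  where
  a b c : ℕ
  a = x n
  b = x (1 + n)
  c = x (2 + n)
  combination : IsSolution (λ m → x m * b + x (1 + m) * (2 * b + a) + x (2 + m) * c)
  combination = IsSolution-+ (IsSolution-+ (IsSolution-*ʳ x-isSolution b)
                                           (IsSolution-*ʳ (IsSolution-suc x-isSolution) (2 * b + a)))
                             (IsSolution-*ʳ (IsSolution-suc (IsSolution-suc x-isSolution)) c)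
  -- the left-hand sides are x (3 + n), x (4 + n) and x (5 + n) unfolded by the recurrence
  initial₀ : ∀ u v w → 2 * w + 2 * v + u ≡ 0 * v + 1 * (2 * v + u) + 2 * w
  initial₀ = solve-∀
  initial₁ : ∀ u v w → 2 * (2 * w + 2 * v + u) + 2 * w + v ≡ 1 * v + 2 * (2 * v + u) + 6 * w
  initial₁ = solve-∀
  initial₂ : ∀ u v w → 2 * (2 * (2 * w + 2 * v + u) + 2 * w + v) + 2 * (2 * w + 2 * v + u) + w
                       ≡ 2 * v + 6 * (2 * v + u) + 17 * w
  initial₂ = solve-∀

x-double-odd : ∀ i →
  x (3 + i * 2) ≡ (x i + x (1 + i)) * (2 * x (1 + i)) + x (2 + i) * x (2 + i)
x-double-odd i = begin
  x (3 + i * 2)                                                               ≡⟨ cong x (index i) ⟩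
  x (i + (3 + i))                                                             ≡⟨ x-+ i i ⟩
  x i * x (1 + i) + x (1 + i) * (2 * x (1 + i) + x i) + x (2 + i) * x (2 + i)
    ≡⟨ regroup (x i) (x (1 + i)) (x (2 + i)) ⟩
  (x i + x (1 + i)) * (2 * x (1 + i)) + x (2 + i) * x (2 + i)                 ∎
  where
  open ≡-Reasoning
  index : ∀ i → 3 + i * 2 ≡ i + (3 + i)
  index = solve-∀
  regroup : ∀ a b c → a * b + b * (2 * b + a) + c * c ≡ (a + b) * (2 * b) + c * c
  regroup = solve-∀

x-double-even : ∀ i →
  x (4 + i * 2) ≡ (x i + (2 * x (1 + i) + x (2 + i))) * (2 * x (2 + i)) + x (1 + i) * x (1 + i)
x-double-even i = begin
  x (4 + i * 2)                                                                     ≡⟨ cong x (index i) ⟩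
  x ((1 + i) + (3 + i))                                                             ≡⟨ x-+ (1 + i) i ⟩
  x (1 + i) * x (1 + i) + x (2 + i) * (2 * x (1 + i) + x i) + x (3 + i) * x (2 + i)
    ≡⟨ regroup (x i) (x (1 + i)) (x (2 + i)) ⟩
  (x i + (2 * x (1 + i) + x (2 + i))) * (2 * x (2 + i)) + x (1 + i) * x (1 + i) ∎
  where
  open ≡-Reasoning
  index : ∀ i → 4 + i * 2 ≡ (1 + i) + (3 + i)
  index = solve-∀
  regroup : ∀ a b c → b * b + c * (2 * b + a) + (2 * c + 2 * b + a) * c ≡ (a + (2 * b + c)) * (2 * c) + b * b
  regroup = solve-∀

module _ (M : ℕ) .{{_ : NonZero M}} where

  %-cong-+ : ∀ {a a′ b b′} → a % M ≡ a′ % M → b % M ≡ b′ % M → (a + b) % M ≡ (a′ + b′) % M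
  %-cong-+ {a} {a′} {b} {b′} a≡a′ b≡b′ = begin
    (a + b) % M           ≡⟨ %-distribˡ-+ a b M ⟩
    (a % M + b % M) % M   ≡⟨ cong₂ (λ u v → (u + v) % M) a≡a′ b≡b′ ⟩
    (a′ % M + b′ % M) % M ≡⟨ %-distribˡ-+ a′ b′ M ⟨
    (a′ + b′) % M         ∎
    where open ≡-Reasoning

  %-cong-*ˡ : ∀ c {a a′} → a % M ≡ a′ % M → (c * a) % M ≡ (c * a′) % M
  %-cong-*ˡ c {a} {a′} a≡a′ = begin
    (c * a) % M           ≡⟨ %-distribˡ-* c a M ⟩
    (c % M * (a % M)) % M ≡⟨ cong (λ u → (c % M * u) % M) a≡a′ ⟩
    (c % M * (a′ % M)) % M ≡⟨ %-distribˡ-* c a′ M ⟨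
    (c * a′) % M          ∎
    where open ≡-Reasoning

  x-periodic : ∀ p → x p % M ≡ x 0 % M → x (1 + p) % M ≡ x 1 % M → x (2 + p) % M ≡ x 2 % M →
               ∀ n → x (p + n) % M ≡ x n % M
  x-periodic p e₀ e₁ e₂ n = subst (λ m → x m % M ≡ x n % M) (+-comm n p)
    (solutions-related (λ a b → a % M ≡ b % M)
       (λ a b c → %-cong-+ (%-cong-+ (%-cong-*ˡ 2 c) (%-cong-*ˡ 2 b)) a)
       (x-shift-isSolution p) x-isSolution e₀ e₁ e₂ n)

  x-periodic-* : ∀ p → (∀ n → x (p + n) % M ≡ x n % M) → ∀ q r → x (r + q * p) % M ≡ x r % M
  x-periodic-* p period zero    r = cong (λ m → x m % M) (+-identityʳ r)
  x-periodic-* p period (suc q) r = begin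
    x (r + (p + q * p)) % M ≡⟨ cong (λ m → x m % M) (x∙yz≈y∙xz r p (q * p)) ⟩
    x (p + (r + q * p)) % M ≡⟨ period (r + q * p) ⟩
    x (r + q * p) % M       ≡⟨ x-periodic-* p period q r ⟩
    x r % M                 ∎
    where open ≡-Reasoning

x-period-6-mod-4 : ∀ n → x (6 + n) % 4 ≡ x n % 4
x-period-6-mod-4 = x-periodic 4 6 refl refl refl

x-period-24-mod-32 : ∀ n → x (24 + n) % 32 ≡ x n % 32
x-period-24-mod-32 = x-periodic 32 24 refl refl refl

Nu2-x-double : ∀ {i} k → Nu2 (x i) 0 → Nu2 (x (1 + i)) (4 + k) → Nu2 (x (2 + i)) (3 + k) →
               Nu2 (x (3 + i * 2)) (5 + k) × Nu2 (x (4 + i * 2)) (4 + k)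
Nu2-x-double {i} k ν₀ ν₁ ν₂ =
  subst (λ v → Nu2 v (5 + k)) (sym (x-double-odd i))
    (Nu2-+ (5 + k) (Nu2-* 0 (5 + k) odd-factor (Nu2-* 1 (4 + k) Nu2-2 ν₁))
                   (*-pres-^∣ 2 3 (3 + k) 8∣x₂ (proj₁ ν₂))) ,
  subst (λ v → Nu2 v (4 + k)) (sym (x-double-even i))
    (Nu2-+ (4 + k) (Nu2-* 0 (4 + k) even-factor (Nu2-* 1 (3 + k) Nu2-2 ν₂))
                   (*-pres-^∣ 2 1 (4 + k) 2∣x₁ (proj₁ ν₁)))
  where
  2∣x₁ : 2 ∣ x (1 + i)
  2∣x₁ = m^[n+o]∣⇒m^n∣ 2 1 (3 + k) (proj₁ ν₁)
  2∣x₂ : 2 ∣ x (2 + i)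
  2∣x₂ = m^[n+o]∣⇒m^n∣ 2 1 (2 + k) (proj₁ ν₂)
  8∣x₂ : 2 ^ 3 ∣ x (2 + i)
  8∣x₂ = m^[n+o]∣⇒m^n∣ 2 3 k (proj₁ ν₂)
  odd-factor : Nu2 (x i + x (1 + i)) 0
  odd-factor = Nu2-+ 0 ν₀ 2∣x₁
  even-factor : Nu2 (x i + (2 * x (1 + i) + x (2 + i))) 0
  even-factor = Nu2-+ 0 ν₀ (∣m∣n⇒∣m+n (m∣m*n (x (1 + i))) 2∣x₂)

x[4+j*6]-odd : ∀ j → Nu2 (x (4 + j * 6)) 0
x[4+j*6]-odd j =
  Nu2-cong-% 0 (divides 2 refl) (sym (x-periodic-* 4 6 x-period-6-mod-4 j 4)) (from-yes (Nu2? (x 4) 0))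

-- m = 1 + j and k = ν₂ m; the positions are 6m − 1 and 6m
Block : ℕ → ℕ → Set
Block j k = Nu2 (suc j) k × Nu2 (x (5 + j * 6)) (4 + k) × Nu2 (x (6 + j * 6)) (3 + k)

Block-odd : ∀ t → Block (t * 2) 0
Block-odd 0 = Nu2-odd 0 , from-yes (Nu2? (x 5) 4) , from-yes (Nu2? (x 6) 3)
Block-odd 1 = Nu2-odd 1 , from-yes (Nu2? (x 17) 4) , from-yes (Nu2? (x 18) 3)
Block-odd (suc (suc t)) =
  let _ , ν₅ , ν₆ = Block-odd t in Nu2-odd (2 + t) , shift 5 4 ∣-refl ν₅ , shift 6 3 (divides 2 refl) ν₆
  where
  -- Indices and implicit arguments are spelled out: leaving them to unification would make
  -- the type checker unfold x some 24 levels deep.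
  index : ∀ r → 24 + (r + t * 2 * 6) ≡ r + suc (suc t) * 2 * 6
  index r = x∙yz≈y∙xz 24 r (t * 2 * 6)
  shift : ∀ r k → 2 ^ suc k ∣ 32 → Nu2 (x (r + t * 2 * 6)) k → Nu2 (x (r + suc (suc t) * 2 * 6)) k
  shift r k 2ᵏ⁺¹∣32 ν =
    subst (λ m → Nu2 (x m) k) (index r)
      (Nu2-cong-% k {a = x (r + t * 2 * 6)} {b = x (24 + (r + t * 2 * 6))} 2ᵏ⁺¹∣32
                  (sym (x-period-24-mod-32 (r + t * 2 * 6))) ν)

Block-double : ∀ t k → Block t k → Block (1 + t * 2) (suc k)
Block-double t k (ν , ν₅ , ν₆) =
  Nu2-*-suc k ν Nu2-2 ,
  subst (λ y → Nu2 (x (11 + y)) (5 + k) × Nu2 (x (12 + y)) (4 + k)) t*6*2≡t*2*6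
        (Nu2-x-double {4 + t * 6} k (x[4+j*6]-odd t) ν₅ ν₆)
  where
  t*6*2≡t*2*6 : t * 6 * 2 ≡ t * 2 * 6
  t*6*2≡t*2*6 = trans (*-assoc t 6 2) (sym (*-assoc t 2 6))

Block-exists : ∀ j → ∃ (Block j)
Block-exists = <-rec _ from-smaller
  where
  from-smaller : ∀ j → (∀ {t} → t < j → ∃ (Block t)) → ∃ (Block j)
  from-smaller j smaller with even⊎odd j
  ... | t , inj₁ refl = 0 , Block-odd t
  ... | t , inj₂ refl = let k , block = smaller (s≤s (m≤m*n t 2)) in suc k , Block-double t k block

Nu2-x-at-6m : ∀ q → 1 ≤ q * 6 → ∃ λ k → Nu2 (q * 6) k × Nu2 (x (q * 6)) (2 + k)
Nu2-x-at-6m (suc j) _ = let k , ν , _ , ν₆ = Block-exists j in suc k , Nu2-*-suc k ν Nu2-6 , ν₆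

Nu2-x-before-6m : ∀ q → ∃ λ k → Nu2 (5 + q * 6 + 1) k × Nu2 (x (5 + q * 6)) (3 + k)
Nu2-x-before-6m q =
  let k , ν , ν₅ , _ = Block-exists q in
  suc k , subst (λ m → Nu2 m (suc k)) (cong (5 +_) (+-comm 1 (q * 6))) (Nu2-*-suc k ν Nu2-6) , ν₅

theorem1p10 : ∀ n → 1 ≤ n →
      ((n % 6 ≡ 1 ⊎ n % 6 ≡ 4) → Nu2 (x n) 0)
    × ((n % 6 ≡ 2 ⊎ n % 6 ≡ 3) → Nu2 (x n) 1)
    × (n % 6 ≡ 0 → ∃ λ k → Nu2 n k × Nu2 (x n) (2 + k))
    × (n % 6 ≡ 5 → ∃ λ k → Nu2 (n + 1) k × Nu2 (x n) (3 + k))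
theorem1p10 n 1≤n =
  [ x-residue 0 (divides 2 refl) (from-yes (Nu2? (x 1) 0)) ,
    x-residue 0 (divides 2 refl) (from-yes (Nu2? (x 4) 0)) ] ,
  [ x-residue 1 ∣-refl (from-yes (Nu2? (x 2) 1)) ,
    x-residue 1 ∣-refl (from-yes (Nu2? (x 3) 1)) ] ,
  (λ n%6≡0 → subst (λ m → ∃ λ k → Nu2 m k × Nu2 (x m) (2 + k)) (sym (n≡r+q*6 n%6≡0))
                   (Nu2-x-at-6m (n / 6) (subst (1 ≤_) (n≡r+q*6 n%6≡0) 1≤n))) ,
  (λ n%6≡5 → subst (λ m → ∃ λ k → Nu2 (m + 1) k × Nu2 (x m) (3 + k)) (sym (n≡r+q*6 n%6≡5))
                   (Nu2-x-before-6m (n / 6)))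
  where
  n≡r+q*6 : ∀ {r} → n % 6 ≡ r → n ≡ r + n / 6 * 6
  n≡r+q*6 refl = m≡m%n+[m/n]*n n 6
  x-residue : ∀ {r} k → 2 ^ suc k ∣ 4 → Nu2 (x r) k → n % 6 ≡ r → Nu2 (x n) k
  x-residue {r} k 2ᵏ⁺¹∣4 ν n%6≡r = Nu2-cong-% k 2ᵏ⁺¹∣4
    (sym (trans (cong (λ m → x m % 4) (n≡r+q*6 n%6≡r)) (x-periodic-* 4 6 x-period-6-mod-4 (n / 6) r))) ν
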